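{- Let $\mathcal{P}=(X,\prec)$ be a poset with $|X|=n$ and dimension at most $2$. Let $M$ be a nonempty canonical maximum matching of the comparability graph $\mathcal{C}(\mathcal{P})$, with $W$ the set of vertices covered by $M$, and let $A=X\setminus W$. Then the equivalence relation on $A$ given by $x\sim y\iff N(x)=N(y)$ has at most $|W|$ equivalence classes.
   Context: A poset $\mathcal{P}=(X,\prec)$ has a finite ground set $X$ and an irreflexive, transitive relation $\prec$. Its dimension is the smallest $d$ such that there are total orders $<_1,\dots,<_d$ on $X$ with $x\prec y$ iff $x<_k y$ for all $k$. The comparability graph $\mathcal{C}(\mathcal{P})$ has vertex set $X$ and edges $\{x,y\}$ whenever $x\prec y$ or $y\prec x$; $N(x)$ denotes the set of elements of $X$ comparable with $x$. For a maximum matching $M$ with covered vertex set $W$ and $A=X\setminus W$, an edge $\{x_i,y_i\}\in M$ with $x_i\prec y_i$ is called separated if there exist $x_1,x_2\in A$ with $x_i\prec x_1$ and $x_2\prec y_i$. A maximum matching is canonical if it contains no separated edges. -}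

module Defs where

open import Data.Nat using (ℕ; _≤_)
open import Data.Fin using (Fin)
open import Data.Product using (Σ; _×_; _,_; ∃; ∃-syntax)
open import Data.List using (List; []; _∷_; length; concatMap)
open import Data.List.Membership.Propositional using (_∈_; _∉_)
open import Data.List.Relation.Unary.All using (All)
open import Data.List.Relation.Unary.Unique.Propositional using (Unique)
open import Relation.Binary.Core using (Rel)
open import Level using (0ℓ)
open import Relation.Binary.Structures using (IsStrictPartialOrder; IsStrictTotalOrder)
open import Relation.Binary.PropositionalEquality using (_≡_)
open import Relation.Nullary using (¬_)
open import Function.Bundles using (_⇔_)

IsPoset : ∀ {n} → Rel (Fin n) 0ℓ → Set
IsPoset _≺_ = IsStrictPartialOrder _≡_ _≺_

-- dimension at most 2: there are two (strict) total orders whose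
-- intersection is ≺ (a realizer of size ≤ 2; a realizer of size 1 can be
-- doubled, and size 0 is impossible for nonempty X / harmless for X = ∅).
DimAtMost2 : ∀ {n} → Rel (Fin n) 0ℓ → Set₁
DimAtMost2 {n} _≺_ =
  Σ (Rel (Fin n) 0ℓ) λ _<₁_ → Σ (Rel (Fin n) 0ℓ) λ _<₂_ →
    IsStrictTotalOrder _≡_ _<₁_ × IsStrictTotalOrder _≡_ _<₂_ ×
    (∀ x y → (x ≺ y) ⇔ (x <₁ y × x <₂ y))

Comp : ∀ {n} → Rel (Fin n) 0ℓ → Fin n → Fin n → Set
Comp _≺_ x y = (x ≺ y) Data.Sum.⊎ (y ≺ x)
  where import Data.Sum

-- A matching of the comparability graph: a list of edges {x,y}, each
-- written as the ordered pair (x , y) with x ≺ y, such that all endpoints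
-- are pairwise distinct.
vertices : ∀ {n} → List (Fin n × Fin n) → List (Fin n)
vertices = concatMap (λ { (x , y) → x ∷ y ∷ [] })

IsMatching : ∀ {n} → Rel (Fin n) 0ℓ → List (Fin n × Fin n) → Set
IsMatching _≺_ M = All (λ { (x , y) → x ≺ y }) M × Unique (vertices M)

IsMaximumMatching : ∀ {n} → Rel (Fin n) 0ℓ → List (Fin n × Fin n) → Set
IsMaximumMatching _≺_ M =
  IsMatching _≺_ M × (∀ M' → IsMatching _≺_ M' → length M' ≤ length M)

-- W = vertices covered by M, A = X ∖ W
InA : ∀ {n} → List (Fin n × Fin n) → Fin n → Set
InA M x = x ∉ vertices M

Separated : ∀ {n} → Rel (Fin n) 0ℓ → List (Fin n × Fin n) → Fin n × Fin n → Set
Separated _≺_ M (xi , yi) =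
  ∃[ x₁ ] ∃[ x₂ ] (InA M x₁ × InA M x₂ × xi ≺ x₁ × x₂ ≺ yi)

IsCanonical : ∀ {n} → Rel (Fin n) 0ℓ → List (Fin n × Fin n) → Set
IsCanonical _≺_ M =
  IsMaximumMatching _≺_ M × (∀ e → e ∈ M → ¬ Separated _≺_ M e)

SameNbhd : ∀ {n} → Rel (Fin n) 0ℓ → Fin n → Fin n → Set
SameNbhd _≺_ x y = ∀ z → Comp _≺_ x z ⇔ Comp _≺_ y z

-- "the relation x ∼ y ⇔ N(x) = N(y) on A has at most k classes":
-- every family of elements of A that are pairwise in distinct classes
-- has at most k members.
ClassesOnAAtMost : ∀ {n} → Rel (Fin n) 0ℓ → List (Fin n × Fin n) → ℕ → Set
ClassesOnAAtMost {n} _≺_ M k =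
  ∀ m (f : Fin m → Fin n) →
    (∀ i → InA M (f i)) →
    (∀ i j → ¬ i ≡ j → ¬ SameNbhd _≺_ (f i) (f j)) →
    m ≤ k

module Submission where

-- By maximality of M the uncovered elements form an antichain, and no edge {x, y} of M
-- has distinct uncovered a ∼ x and b ∼ y (that would be an augmenting path).  Order the
-- antichain by the first linear order of a realizer.  For each edge, the antichain elements
-- comparable to x or to y then form an interval: dimension two makes each neighbourhood
-- convex, and a mixed pattern would give an augmenting path.  Elements with different
-- neighbourhoods are separated by one of these |M| intervals, since every neighbour of an
-- uncovered element is covered.  Finally, k intervals separating the points of a chain
-- leave room for at most 2k points as soon as one end of the chain lies in some interval,
-- which (reversing the chain if necessary) fails only for a one-point chain.

open import Defs
open import Data.Nat using (ℕ; zero; suc; _+_; _≤_; _<_; z≤n; s≤s)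
open import Data.Nat.Properties
  using (≤-trans; ≤-refl; m≤m+n; m≤n⇒m≤1+n; +-suc; +-mono-≤; <⇒≱)
open import Data.Fin using (Fin; zero; suc; join; splitAt) renaming (_≟_ to _≟ᶠ_)
open import Data.Fin.Properties using (splitAt-join; injective⇒≤; any?)
open import Data.Product using (_×_; _,_; ∃; proj₁; proj₂)
open import Data.Sum using (_⊎_; inj₁; inj₂)
open import Data.Unit using (⊤; tt)
open import Data.Empty using (⊥; ⊥-elim)
open import Data.List using (List; []; _∷_; length; _++_; lookup; allFin)
open import Data.List.Membership.Propositional using (_∈_; _∉_)
open import Data.List.Membership.Propositional.Properties using (∈-∃++; ∈-lookup; ∈-allFin)
import Data.List.Membership.DecPropositional as DecMembership
open import Data.List.Relation.Unary.Any using (here; there)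
open import Data.List.Relation.Unary.All as All using (All; []; _∷_)
open import Data.List.Relation.Unary.All.Properties.Core using (¬Any⇒All¬)
open import Data.List.Relation.Unary.AllPairs using (_∷_)
open import Data.List.Relation.Binary.Permutation.Propositional as ↭
  using (_↭_; ↭-refl; ↭-prep; ↭-swap; ↭-trans; ↭-sym; ↭⇒↭ₛ; module PermutationReasoning)
open import Data.List.Relation.Binary.Permutation.Propositional.Properties
  using (↭-length; ++⁺ˡ; shift; shifts; All-resp-↭)
import Data.List.Relation.Binary.Permutation.Setoid.Properties as SetoidPermutation
open import Function using (_∘_; flip)
open import Function.Bundles using (_⇔_; mk⇔; Equivalence)
open import Function.Definitions using (Injective)
open import Level using (0ℓ)
open import Relation.Binary.Core using (Rel)
open import Relation.Binary.Definitions using (Irreflexive; Trichotomous; tri<; tri≈; tri>)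
open import Relation.Binary.Structures using (IsStrictTotalOrder; IsStrictPartialOrder)
open import Relation.Binary.Structures.Biased using (isStrictTotalOrderᶜ)
open import Relation.Binary.PropositionalEquality
  using (_≡_; _≢_; refl; sym; cong; subst; setoid; isEquivalence; module ≡-Reasoning)
import Relation.Binary.PropositionalEquality as ≡
open import Relation.Nullary using (¬_; Dec; yes; no; contradiction)
open import Relation.Nullary.Decidable using (map′; _×-dec_; _⊎-dec_; ¬?)
open import Relation.Unary using (Pred; Decidable)

module _ {n : ℕ} where

  length-vertices : (M : List (Fin n × Fin n)) → length (vertices M) ≡ length M + length M
  length-vertices []      = refl
  length-vertices (_ ∷ M) =
    cong suc (≡.trans (cong suc (length-vertices M)) (sym (+-suc (length M) (length M))))

  vertices-↭ : {M N : List (Fin n × Fin n)} → M ↭ N → vertices M ↭ vertices N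
  vertices-↭ ↭.refl                     = ↭-refl
  vertices-↭ (↭.prep (x , y) σ)         = ↭-prep x (↭-prep y (vertices-↭ σ))
  vertices-↭ (↭.swap (x , y) (u , v) σ) =
    ↭-trans (shifts (x ∷ y ∷ []) (u ∷ v ∷ [])) (++⁺ˡ (u ∷ v ∷ x ∷ y ∷ []) (vertices-↭ σ))
  vertices-↭ (↭.trans σ τ)              = ↭-trans (vertices-↭ σ) (vertices-↭ τ)

  ∈-vertices⁻ : ∀ {z} (M : List (Fin n × Fin n)) → z ∈ vertices M →
    ∃ λ e → z ≡ proj₁ (lookup M e) ⊎ z ≡ proj₂ (lookup M e)
  ∈-vertices⁻ (_ ∷ M) (here z≡x)          = zero , inj₁ z≡x
  ∈-vertices⁻ (_ ∷ M) (there (here z≡y))  = zero , inj₂ z≡y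
  ∈-vertices⁻ (_ ∷ M) (there (there z∈)) with e , z∈e ← ∈-vertices⁻ M z∈ = suc e , z∈e

-- Augmenting a maximum matching

module Matching {n : ℕ} {_≺_ : Rel (Fin n) 0ℓ} (≺-irrefl : Irreflexive _≡_ _≺_) where

  Upward : Fin n × Fin n → Set
  Upward (x , y) = x ≺ y

  comparable⇒edge : ∀ {a x} → Comp _≺_ a x →
    ∃ λ e → Upward e × ∀ L → proj₁ e ∷ proj₂ e ∷ L ↭ a ∷ x ∷ L
  comparable⇒edge {a} {x} (inj₁ a≺x) = (a , x) , a≺x , λ _ → ↭-refl
  comparable⇒edge {a} {x} (inj₂ x≺a) = (x , a) , x≺a , λ _ → ↭-swap x a ↭-refl

  comparable⇒≢ : ∀ {a b} → Comp _≺_ a b → a ≢ b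
  comparable⇒≢ (inj₁ a≺b) refl = ≺-irrefl refl a≺b
  comparable⇒≢ (inj₂ b≺a) refl = ≺-irrefl refl b≺a

  -- N has one more edge than M because it covers two more vertices.
  cannot-cover-two-more : ∀ {M a b} → IsMaximumMatching _≺_ M →
    a ≢ b → a ∉ vertices M → b ∉ vertices M →
    (N : List (Fin n × Fin n)) → All Upward N → vertices N ↭ a ∷ b ∷ vertices M → ⊥
  cannot-cover-two-more {M} ((_ , unique) , maximum) a≢b a∉ b∉ N upward σ =
    <⇒≱ longer (+-mono-≤ N≤M N≤M)
    where
    N≤M : length N ≤ length M
    N≤M = maximum N (upward ,
      SetoidPermutation.Unique-resp-↭ (setoid _) (↭⇒↭ₛ (↭-sym σ))
        ((a≢b ∷ ¬Any⇒All¬ _ a∉) ∷ ¬Any⇒All¬ _ b∉ ∷ unique))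
    longer : length M + length M < length N + length N
    longer = subst (length M + length M <_) (begin
      2 + (length M + length M)     ≡⟨ cong (2 +_) (length-vertices M) ⟨
      2 + length (vertices M)       ≡⟨ ↭-length σ ⟨
      length (vertices N)           ≡⟨ length-vertices N ⟩
      length N + length N           ∎) (m≤n⇒m≤1+n ≤-refl)
      where open ≡-Reasoning

  uncovered-incomparable : ∀ {M a b} → IsMaximumMatching _≺_ M →
    a ∉ vertices M → b ∉ vertices M → ¬ Comp _≺_ a b
  uncovered-incomparable {M} maximum a∉ b∉ a∼b
    with e , e-up , e-vertices ← comparable⇒edge a∼b =
    cannot-cover-two-more maximum (comparable⇒≢ a∼b) a∉ b∉
      (e ∷ M) (e-up ∷ proj₁ (proj₁ maximum)) (e-vertices _)

  no-augmenting-path : ∀ {M a b x y} → IsMaximumMatching _≺_ M → (x , y) ∈ M →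
    a ≢ b → a ∉ vertices M → b ∉ vertices M → Comp _≺_ a x → Comp _≺_ b y → ⊥
  no-augmenting-path {M} {a} {b} {x} {y} maximum xy∈M a≢b a∉ b∉ a∼x b∼y
    with M₁ , M₂ , refl ← ∈-∃++ xy∈M
    with e₁ , e₁-up , e₁-vertices ← comparable⇒edge a∼x
    with e₂ , e₂-up , e₂-vertices ← comparable⇒edge b∼y =
    cannot-cover-two-more maximum a≢b a∉ b∉ (e₁ ∷ e₂ ∷ M₁ ++ M₂)
      (e₁-up ∷ e₂-up ∷ All.tail (All-resp-↭ σ (proj₁ (proj₁ maximum)))) vertices-↭-augmented
    where
    σ : M ↭ (x , y) ∷ M₁ ++ M₂
    σ = shift (x , y) M₁ M₂
    vertices-↭-augmented : vertices (e₁ ∷ e₂ ∷ M₁ ++ M₂) ↭ a ∷ b ∷ vertices M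
    vertices-↭-augmented = begin
      vertices (e₁ ∷ e₂ ∷ M₁ ++ M₂)       ↭⟨ e₁-vertices _ ⟩
      a ∷ x ∷ vertices (e₂ ∷ M₁ ++ M₂)    ↭⟨ ↭-prep a (↭-prep x (e₂-vertices _)) ⟩
      a ∷ x ∷ b ∷ y ∷ vertices (M₁ ++ M₂) ↭⟨ ↭-prep a (↭-swap x b ↭-refl) ⟩
      a ∷ b ∷ x ∷ y ∷ vertices (M₁ ++ M₂) ↭⟨ ↭-prep a (↭-prep b (vertices-↭ (↭-sym σ))) ⟩
      a ∷ b ∷ vertices M                  ∎
      where open PermutationReasoning

-- Intervals in a finite chain

module _ {m : ℕ} where

  Convex : Rel (Fin m) 0ℓ → Pred (Fin m) 0ℓ → Set
  Convex _⊏_ P = ∀ {a b c} → a ⊏ b → b ⊏ c → P a → P c → P b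

  Splits : Pred (Fin m) 0ℓ → Fin m → Fin m → Set
  Splits P a b = (P a × ¬ P b) ⊎ (¬ P a × P b)

  splits? : {P : Pred (Fin m) 0ℓ} → Decidable P → ∀ a b → Dec (Splits P a b)
  splits? P? a b = (P? a ×-dec ¬? (P? b)) ⊎-dec (¬? (P? a) ×-dec P? b)

  flip-isStrictTotalOrder : {_⊏_ : Rel (Fin m) 0ℓ} →
    IsStrictTotalOrder _≡_ _⊏_ → IsStrictTotalOrder _≡_ (flip _⊏_)
  flip-isStrictTotalOrder sto = isStrictTotalOrderᶜ record
    { isEquivalence = isEquivalence
    ; trans         = flip (IsStrictTotalOrder.trans sto)
    ; compare       = compare′
    }
    where
    compare′ : Trichotomous _≡_ (flip _)
    compare′ a b with IsStrictTotalOrder.compare sto b a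
    ... | tri< b⊏a a≢b a⋢b = tri< b⊏a (a≢b ∘ sym) a⋢b
    ... | tri≈ b⋢a b≡a a⋢b = tri≈ b⋢a (sym b≡a) a⋢b
    ... | tri> b⋢a a≢b a⊏b = tri> b⋢a (a≢b ∘ sym) a⊏b

module Extrema {m : ℕ} {_⊏_ : Rel (Fin m) 0ℓ} (sto : IsStrictTotalOrder _≡_ _⊏_) where
  open IsStrictTotalOrder sto

  Minimal Maximal : Pred (Fin m) 0ℓ
  Minimal a = ∀ b → ¬ b ⊏ a
  Maximal a = ∀ b → ¬ a ⊏ b

  IsGreatest : Pred (Fin m) 0ℓ → Pred (Fin m) 0ℓ
  IsGreatest P g = P g × ∀ a → P a → ¬ g ⊏ a

  greatest : {P : Pred (Fin m) 0ℓ} → Decidable P → (∀ a → ¬ P a) ⊎ ∃ (IsGreatest P)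
  greatest {P} P? with greatest-of (allFin m)
    where
    greatest-of : (xs : List (Fin m)) →
      All (¬_ ∘ P) xs ⊎ ∃ λ g → P g × All (λ a → P a → ¬ g ⊏ a) xs
    greatest-of []       = inj₁ []
    greatest-of (x ∷ xs) with P? x | greatest-of xs
    ... | no ¬Px | inj₁ none           = inj₁ (¬Px ∷ none)
    ... | no ¬Px | inj₂ (g , Pg , top) = inj₂ (g , Pg , (λ Px → contradiction Px ¬Px) ∷ top)
    ... | yes Px | inj₁ none           =
      inj₂ (x , Px , (λ _ → irrefl refl) ∷ All.map (λ ¬Pa Pa → contradiction Pa ¬Pa) none)
    ... | yes Px | inj₂ (g , Pg , top) with compare x g
    ...   | tri< x⊏g _ _  = inj₂ (g , Pg , (λ _ → asym x⊏g) ∷ top)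
    ...   | tri≈ _ refl _ = inj₂ (g , Pg , (λ _ → irrefl refl) ∷ top)
    ...   | tri> _ _ g⊏x  =
      inj₂ (x , Px , (λ _ → irrefl refl) ∷ All.map (λ g-top Pa x⊏a → g-top Pa (trans g⊏x x⊏a)) top)
  ... | inj₁ none           = inj₁ λ a → All.lookup none (∈-allFin a)
  ... | inj₂ (g , Pg , top) = inj₂ (g , Pg , λ a → All.lookup top (∈-allFin a))

  maximum : (Fin m → ⊥) ⊎ ∃ Maximal
  maximum with greatest {P = λ _ → ⊤} (λ _ → yes tt)
  ... | inj₁ empty          = inj₁ λ a → empty a tt
  ... | inj₂ (g , _ , top)  = inj₂ (g , λ a → top a tt)

  minimal-unique : ∀ {a b} → Minimal a → Minimal b → a ≡ b
  minimal-unique {a} {b} a-min b-min with compare a b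
  ... | tri< a⊏b _ _ = contradiction a⊏b (b-min a)
  ... | tri≈ _ a≡b _ = a≡b
  ... | tri> _ _ b⊏a = contradiction b⊏a (a-min b)

  _⋖_ : Rel (Fin m) 0ℓ
  p ⋖ a = IsGreatest (_⊏ a) p

  predecessor : ∀ a → Minimal a ⊎ ∃ (_⋖ a)
  predecessor a = greatest (_<? a)

join-injective : ∀ {k l} {s t : Fin k ⊎ Fin l} → join k l s ≡ join k l t → s ≡ t
join-injective {k} {l} {s} {t} eq = begin
  s                      ≡⟨ splitAt-join k l s ⟨
  splitAt k (join k l s) ≡⟨ cong (splitAt k) eq ⟩
  splitAt k (join k l t) ≡⟨ splitAt-join k l t ⟩
  t                      ∎
  where open ≡-Reasoning

-- The two boundary points of an interval are its least element and the successor of its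
-- greatest.  Every point of the chain except possibly the least one is a boundary point.
module BoundaryPoints {m k : ℕ} {_⊏_ : Rel (Fin m) 0ℓ} (sto : IsStrictTotalOrder _≡_ _⊏_)
  (J : Fin k → Pred (Fin m) 0ℓ) (J-convex : ∀ e → Convex _⊏_ (J e))
  (J-separates : ∀ {a b} → a ≢ b → ∃ λ e → Splits (J e) a b) where
  open IsStrictTotalOrder sto
  open Extrema sto

  IsBoundary : Fin k ⊎ Fin k → Pred (Fin m) 0ℓ
  IsBoundary (inj₁ e) a = J e a × (∀ b → b ⊏ a → ¬ J e b)
  IsBoundary (inj₂ e) a = ¬ J e a × ∃ λ p → p ⋖ a × J e p

  boundary-⊏-⊥ : ∀ {t a b} → a ⊏ b → IsBoundary t a → IsBoundary t b → ⊥
  boundary-⊏-⊥ {inj₁ e} a⊏b (Ja , _) (_ , b-first) = b-first _ a⊏b Ja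
  boundary-⊏-⊥ {inj₂ e} {a} a⊏b (¬Ja , p , (p⊏a , _) , Jp) (_ , q , (q⊏b , q-top) , Jq)
    with compare q a
  ... | tri< q⊏a _ _  = q-top a a⊏b q⊏a
  ... | tri≈ _ refl _ = ¬Ja Jq
  ... | tri> _ _ a⊏q  = ¬Ja (J-convex e p⊏a a⊏q Jp Jq)

  boundary-unique : ∀ {t a b} → IsBoundary t a → IsBoundary t b → a ≡ b
  boundary-unique {t} {a} {b} ta tb with compare a b
  ... | tri< a⊏b _ _ = ⊥-elim (boundary-⊏-⊥ a⊏b ta tb)
  ... | tri≈ _ a≡b _ = a≡b
  ... | tri> _ _ b⊏a = ⊥-elim (boundary-⊏-⊥ b⊏a tb ta)

  boundary-exists : (∀ a → Minimal a → ∃ λ e → J e a) → ∀ a → ∃ λ t → IsBoundary t a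
  boundary-exists minimal-covered a with predecessor a
  ... | inj₁ a-min with e , Ja ← minimal-covered a a-min =
    inj₁ e , Ja , λ b b⊏a _ → a-min b b⊏a
  ... | inj₂ (p , p⋖a@(p⊏a , p-top)) with J-separates (λ { refl → irrefl refl p⊏a })
  ...   | e , inj₁ (Jp , ¬Ja) = inj₂ e , ¬Ja , p , p⋖a , Jp
  ...   | e , inj₂ (¬Jp , Ja) = inj₁ e , Ja , below
    where
    below : ∀ b → b ⊏ a → ¬ J e b
    below b b⊏a Jb with compare b p
    ... | tri< b⊏p _ _  = ¬Jp (J-convex e b⊏p p⊏a Jb Ja)
    ... | tri≈ _ refl _ = ¬Jp Jb
    ... | tri> _ _ p⊏b  = p-top b b⊏a p⊏b

  count-boundaries : (∀ a → Minimal a → ∃ λ e → J e a) → m ≤ k + k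
  count-boundaries minimal-covered = injective⇒≤ {f = join k k ∘ boundary} injective
    where
    boundary : Fin m → Fin k ⊎ Fin k
    boundary a = proj₁ (boundary-exists minimal-covered a)
    is-boundary : ∀ a → IsBoundary (boundary a) a
    is-boundary a = proj₂ (boundary-exists minimal-covered a)
    injective : Injective _≡_ _≡_ (join k k ∘ boundary)
    injective {a} {b} eq =
      boundary-unique (subst (λ t → IsBoundary t a) (join-injective eq) (is-boundary a))
                      (is-boundary b)

module SeparatingIntervals {m k : ℕ} {_⊏_ : Rel (Fin m) 0ℓ} (sto : IsStrictTotalOrder _≡_ _⊏_)
  (J : Fin k → Pred (Fin m) 0ℓ) (J? : ∀ e → Decidable (J e)) (J-convex : ∀ e → Convex _⊏_ (J e))
  (J-separates : ∀ {a b} → a ≢ b → ∃ λ e → Splits (J e) a b) where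
  open IsStrictTotalOrder sto using (compare; _≟_)
  private
    module Ascending = Extrema sto
    module Descending = Extrema (flip-isStrictTotalOrder sto)
    module AscendingBoundaries = BoundaryPoints sto J J-convex J-separates
    module DescendingBoundaries = BoundaryPoints (flip-isStrictTotalOrder sto) J
      (λ e c⊏b b⊏a Jc Ja → J-convex e b⊏a c⊏b Ja Jc) J-separates

  empty⇒≤ : (Fin m → ⊥) → m ≤ k + k
  empty⇒≤ empty = injective⇒≤ {f = ⊥-elim ∘ empty} λ {a} → ⊥-elim (empty a)

  -- Ends lying in no interval are not separated, hence coincide.
  uncovered-ends⇒≤1 : ∀ {bot top} → Ascending.Minimal bot → Ascending.Maximal top →
    ¬ (∃ λ e → J e bot) → ¬ (∃ λ e → J e top) → m ≤ 1
  uncovered-ends⇒≤1 {bot} {top} bot-min top-max bot-uncovered top-uncovered =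
    injective⇒≤ {f = λ _ → zero {0}} λ {a} {b} _ → ≡.trans (≡bot a) (sym (≡bot b))
    where
    bot≡top : bot ≡ top
    bot≡top with bot ≟ top
    ... | yes bot≡top = bot≡top
    ... | no bot≢top with J-separates bot≢top
    ...   | e , inj₁ (J-bot , _) = contradiction (e , J-bot) bot-uncovered
    ...   | e , inj₂ (_ , J-top) = contradiction (e , J-top) top-uncovered
    ≡bot : ∀ a → a ≡ bot
    ≡bot a with compare a bot
    ... | tri< a⊏bot _ _ = contradiction a⊏bot (bot-min a)
    ... | tri≈ _ a≡bot _ = a≡bot
    ... | tri> _ _ bot⊏a = contradiction (subst (_⊏ a) bot≡top bot⊏a) (top-max a)

  bound : 0 < k → m ≤ k + k
  bound 0<k with Ascending.maximum | Descending.maximum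
  ... | inj₁ empty | _          = empty⇒≤ empty
  ... | inj₂ _     | inj₁ empty = empty⇒≤ empty
  ... | inj₂ (top , top-max) | inj₂ (bot , bot-min)
    with any? (λ e → J? e bot) | any? (λ e → J? e top)
  ...   | yes (e , J-bot) | _ = AscendingBoundaries.count-boundaries λ a a-min →
          e , subst (J e) (Ascending.minimal-unique bot-min a-min) J-bot
  ...   | no _ | yes (e , J-top) = DescendingBoundaries.count-boundaries λ a a-max →
          e , subst (J e) (Descending.minimal-unique top-max a-max) J-top
  ...   | no bot-uncovered | no top-uncovered =
          ≤-trans (uncovered-ends⇒≤1 bot-min top-max bot-uncovered top-uncovered)
                  (≤-trans 0<k (m≤m+n k k))

-- Posets of dimension two

module TwoDimensional {n : ℕ} {_≺_ : Rel (Fin n) 0ℓ} (poset : IsPoset _≺_)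
  {_<₁_ _<₂_ : Rel (Fin n) 0ℓ}
  (sto₁ : IsStrictTotalOrder _≡_ _<₁_) (sto₂ : IsStrictTotalOrder _≡_ _<₂_)
  (realizes : ∀ x y → (x ≺ y) ⇔ (x <₁ y × x <₂ y)) where
  private
    module P = IsStrictPartialOrder poset
    module L₁ = IsStrictTotalOrder sto₁
    module L₂ = IsStrictTotalOrder sto₂

  ≺⇒<₁ : ∀ {x y} → x ≺ y → x <₁ y
  ≺⇒<₁ = proj₁ ∘ Equivalence.to (realizes _ _)

  ≺⇒<₂ : ∀ {x y} → x ≺ y → x <₂ y
  ≺⇒<₂ = proj₂ ∘ Equivalence.to (realizes _ _)

  <₁∧<₂⇒≺ : ∀ {x y} → x <₁ y → x <₂ y → x ≺ y
  <₁∧<₂⇒≺ x<₁y x<₂y = Equivalence.from (realizes _ _) (x<₁y , x<₂y)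

  comparable? : ∀ x y → Dec (Comp _≺_ x y)
  comparable? x y = x ≺? y ⊎-dec y ≺? x
    where
    _≺?_ : ∀ x y → Dec (x ≺ y)
    x ≺? y = map′ (λ (x<₁y , x<₂y) → <₁∧<₂⇒≺ x<₁y x<₂y) (λ x≺y → ≺⇒<₁ x≺y , ≺⇒<₂ x≺y)
      (x L₁.<? y ×-dec x L₂.<? y)

  incomparable-<₁⇒>₂ : ∀ {a b} → a <₁ b → ¬ Comp _≺_ a b → b <₂ a
  incomparable-<₁⇒>₂ {a} {b} a<₁b a≁b with L₂.compare a b
  ... | tri< a<₂b _ _ = contradiction (inj₁ (<₁∧<₂⇒≺ a<₁b a<₂b)) a≁b
  ... | tri≈ _ refl _ = contradiction a<₁b (L₁.irrefl refl)
  ... | tri> _ _ b<₂a = b<₂a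

  comparable-convex : ∀ {a b c w} → a <₁ b → b <₁ c →
    ¬ Comp _≺_ a b → ¬ Comp _≺_ b c → ¬ Comp _≺_ a c →
    Comp _≺_ a w → Comp _≺_ c w → Comp _≺_ b w
  comparable-convex a<₁b b<₁c a≁b _ _ (inj₁ a≺w) (inj₁ c≺w) =
    inj₁ (<₁∧<₂⇒≺ (L₁.trans b<₁c (≺⇒<₁ c≺w))
                  (L₂.trans (incomparable-<₁⇒>₂ a<₁b a≁b) (≺⇒<₂ a≺w)))
  comparable-convex a<₁b b<₁c _ b≁c _ (inj₂ w≺a) (inj₂ w≺c) =
    inj₂ (<₁∧<₂⇒≺ (L₁.trans (≺⇒<₁ w≺a) a<₁b)
                  (L₂.trans (≺⇒<₂ w≺c) (incomparable-<₁⇒>₂ b<₁c b≁c)))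
  comparable-convex _ _ _ _ a≁c (inj₁ a≺w) (inj₂ w≺c) =
    contradiction (inj₁ (P.trans a≺w w≺c)) a≁c
  comparable-convex _ _ _ _ a≁c (inj₂ w≺a) (inj₁ c≺w) =
    contradiction (inj₂ (P.trans c≺w w≺a)) a≁c

-- Neighbourhood classes of uncovered elements

module UncoveredClasses {n : ℕ} {_≺_ : Rel (Fin n) 0ℓ} (poset : IsPoset _≺_)
  {_<₁_ _<₂_ : Rel (Fin n) 0ℓ}
  (sto₁ : IsStrictTotalOrder _≡_ _<₁_) (sto₂ : IsStrictTotalOrder _≡_ _<₂_)
  (realizes : ∀ x y → (x ≺ y) ⇔ (x <₁ y × x <₂ y))
  {M : List (Fin n × Fin n)} (maximum : IsMaximumMatching _≺_ M)
  {m : ℕ} (f : Fin m → Fin n) (f-uncovered : ∀ i → InA M (f i))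
  (f-distinct : ∀ i j → i ≢ j → ¬ SameNbhd _≺_ (f i) (f j)) where
  open TwoDimensional poset sto₁ sto₂ realizes
  open Matching (IsStrictPartialOrder.irrefl poset)
  open DecMembership (_≟ᶠ_ {n}) using (_∈?_)
  private
    module L₁ = IsStrictTotalOrder sto₁

  f-antichain : ∀ i j → ¬ Comp _≺_ (f i) (f j)
  f-antichain i j = uncovered-incomparable maximum (f-uncovered i) (f-uncovered j)

  f-injective : Injective _≡_ _≡_ f
  f-injective {i} {j} fi≡fj with i ≟ᶠ j
  ... | yes i≡j = i≡j
  ... | no i≢j  = contradiction same-neighbourhood (f-distinct i j i≢j)
    where
    same-neighbourhood : SameNbhd _≺_ (f i) (f j)
    same-neighbourhood z =
      mk⇔ (subst (λ x → Comp _≺_ x z) fi≡fj) (subst (λ x → Comp _≺_ x z) (sym fi≡fj))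

  _⊏_ : Rel (Fin m) 0ℓ
  i ⊏ j = f i <₁ f j

  ⊏-isStrictTotalOrder : IsStrictTotalOrder _≡_ _⊏_
  ⊏-isStrictTotalOrder = isStrictTotalOrderᶜ record
    { isEquivalence = isEquivalence
    ; trans         = L₁.trans
    ; compare       = compare
    }
    where
    compare : Trichotomous _≡_ _⊏_
    compare i j with L₁.compare (f i) (f j)
    ... | tri< i⊏j fi≢fj j⋢i = tri< i⊏j (fi≢fj ∘ cong f) j⋢i
    ... | tri≈ i⋢j fi≡fj j⋢i = tri≈ i⋢j (f-injective fi≡fj) j⋢i
    ... | tri> i⋢j fi≢fj j⊏i = tri> i⋢j (fi≢fj ∘ cong f) j⊏i

  lower upper : Fin (length M) → Fin n
  lower e = proj₁ (lookup M e)
  upper e = proj₂ (lookup M e)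

  Touches : Fin (length M) → Pred (Fin m) 0ℓ
  Touches e i = Comp _≺_ (f i) (lower e) ⊎ Comp _≺_ (f i) (upper e)

  touches? : ∀ e → Decidable (Touches e)
  touches? e i = comparable? (f i) (lower e) ⊎-dec comparable? (f i) (upper e)

  no-augmenting-path-through : ∀ e {i j} → i ≢ j →
    Comp _≺_ (f i) (lower e) → Comp _≺_ (f j) (upper e) → ⊥
  no-augmenting-path-through e i≢j =
    no-augmenting-path maximum (∈-lookup e) (i≢j ∘ f-injective) (f-uncovered _) (f-uncovered _)

  touches-convex : ∀ e → Convex _⊏_ (Touches e)
  touches-convex e {a} {b} {c} a⊏b b⊏c = touches
    where
    a≢c : a ≢ c
    a≢c refl = L₁.irrefl refl (L₁.trans a⊏b b⊏c)
    convex : ∀ {w} → Comp _≺_ (f a) w → Comp _≺_ (f c) w → Comp _≺_ (f b) w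
    convex = comparable-convex a⊏b b⊏c (f-antichain a b) (f-antichain b c) (f-antichain a c)
    touches : Touches e a → Touches e c → Touches e b
    touches (inj₁ a∼x) (inj₁ c∼x) = inj₁ (convex a∼x c∼x)
    touches (inj₂ a∼y) (inj₂ c∼y) = inj₂ (convex a∼y c∼y)
    touches (inj₁ a∼x) (inj₂ c∼y) = ⊥-elim (no-augmenting-path-through e a≢c a∼x c∼y)
    touches (inj₂ a∼y) (inj₁ c∼x) = ⊥-elim (no-augmenting-path-through e (a≢c ∘ sym) c∼x a∼y)

  touching-same-edges⇒endpoint : ∀ {i j} → i ≢ j → (∀ e → Touches e i → Touches e j) →
    ∀ e {z} → z ≡ lower e ⊎ z ≡ upper e → Comp _≺_ (f i) z → Comp _≺_ (f j) z
  touching-same-edges⇒endpoint i≢j touched e (inj₁ refl) fi∼x with touched e (inj₁ fi∼x)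
  ... | inj₁ fj∼x = fj∼x
  ... | inj₂ fj∼y = ⊥-elim (no-augmenting-path-through e i≢j fi∼x fj∼y)
  touching-same-edges⇒endpoint i≢j touched e (inj₂ refl) fi∼y with touched e (inj₂ fi∼y)
  ... | inj₂ fj∼y = fj∼y
  ... | inj₁ fj∼x = ⊥-elim (no-augmenting-path-through e (i≢j ∘ sym) fj∼x fi∼y)

  touching-same-edges⇒⊆ : ∀ {i j} → i ≢ j → (∀ e → Touches e i → Touches e j) →
    ∀ z → Comp _≺_ (f i) z → Comp _≺_ (f j) z
  touching-same-edges⇒⊆ {i} i≢j touched z fi∼z with z ∈? vertices M
  ... | no z∉  = contradiction fi∼z (uncovered-incomparable maximum (f-uncovered i) z∉)
  ... | yes z∈ = let e , z∈e = ∈-vertices⁻ M z∈ in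
    touching-same-edges⇒endpoint i≢j touched e z∈e fi∼z

  touches-separates : ∀ {i j} → i ≢ j → ∃ λ e → Splits (Touches e) i j
  touches-separates {i} {j} i≢j with any? (λ e → splits? (touches? e) i j)
  ... | yes split = split
  ... | no unsplit = contradiction same-neighbourhood (f-distinct i j i≢j)
    where
    i⇒j : ∀ e → Touches e i → Touches e j
    i⇒j e ti with touches? e j
    ... | yes tj = tj
    ... | no ¬tj = contradiction (e , inj₁ (ti , ¬tj)) unsplit
    j⇒i : ∀ e → Touches e j → Touches e i
    j⇒i e tj with touches? e i
    ... | yes ti = ti
    ... | no ¬ti = contradiction (e , inj₂ (¬ti , tj)) unsplit
    same-neighbourhood : SameNbhd _≺_ (f i) (f j)
    same-neighbourhood z =
      mk⇔ (touching-same-edges⇒⊆ i≢j i⇒j z) (touching-same-edges⇒⊆ (i≢j ∘ sym) j⇒i z)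

  bound : 0 < length M → m ≤ length M + length M
  bound =
    SeparatingIntervals.bound ⊏-isStrictTotalOrder Touches touches? touches-convex touches-separates

lemma5 : (n : ℕ) (_≺_ : Rel (Fin n) 0ℓ) → IsPoset _≺_ → DimAtMost2 _≺_ →
    (M : List (Fin n × Fin n)) → ¬ M ≡ [] → IsCanonical _≺_ M →
    ClassesOnAAtMost _≺_ M (length (vertices M))
lemma5 n _≺_ poset dim [] M≢[] = contradiction refl M≢[]
lemma5 n _≺_ poset (_ , _ , sto₁ , sto₂ , realizes) M@(_ ∷ _) _ (maximum , _)
       m f f-uncovered f-distinct =
  subst (m ≤_) (sym (length-vertices M))
    (UncoveredClasses.bound poset sto₁ sto₂ realizes maximum f f-uncovered f-distinct (s≤s z≤n))
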